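{- Let $H$ be a finite simple graph that contains no induced subgraph isomorphic to $K_4-e$ (the complete graph on four vertices with one edge deleted) and no induced subgraph isomorphic to $K_{1,4}$. Then there exists a locally linear graph $G$ whose triangle graph $G^*$ is isomorphic to $H$, and this locally linear graph $G$ is unique up to isomorphism.
   Context: All graphs are finite, simple and undirected. A graph $G$ is locally linear if it has no isolated vertices and for every vertex $v$ the subgraph induced on its neighbourhood $N(v)=\{w\in V(G): w\sim v, w\neq v\}$ is $1$-regular; equivalently, every edge of $G$ lies in exactly one triangle (so two distinct triangles of $G$ share at most one vertex). The triangle graph $G^*$ of a locally linear graph $G$ is the graph whose vertex set is the set of triangles of $G$, two distinct triangles being adjacent in $G^*$ if and only if they share a common vertex in $G$. -}

module Defs where

open import Data.Nat using (ℕ)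
open import Data.Fin using (Fin; _<_; zero; suc)
open import Data.Bool using (Bool; true; false; T)
open import Data.Product using (Σ; ∃; ∃-syntax; _×_; _,_)
open import Data.Sum using (_⊎_)
open import Relation.Nullary using (¬_)
open import Relation.Binary.PropositionalEquality using (_≡_; _≢_)
open import Function.Bundles using (_↔_; _⇔_; Inverse)
open import Function.Definitions using (Injective)

record FinGraph (n : ℕ) : Set where
  field
    E     : Fin n → Fin n → Bool
    sym   : ∀ x y → E x y ≡ E y x
    irrefl : ∀ x → E x x ≡ false
open FinGraph public

FiniteGraph : Set
FiniteGraph = Σ ℕ FinGraph

record Graph : Set₁ where
  field
    V   : Set
    _~_ : V → V → Set
open Graph public

record _≅_ (G H : Graph) : Set where
  field
    bij  : V G ↔ V H
    pres : ∀ x y → (_~_ G x y) ⇔ (_~_ H (Inverse.to bij x) (Inverse.to bij y))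

⟦_⟧ : FiniteGraph → Graph
⟦ (n , G) ⟧ = record { V = Fin n ; _~_ = λ x y → T (E G x y) }

-- Locally linear: no isolated vertices, and for each vertex v, the
-- subgraph induced on N(v) is 1-regular (every neighbour w of v has
-- exactly one neighbour u inside N(v)).
LocallyLinear : FiniteGraph → Set
LocallyLinear (n , G) =
  (∀ v → ∃[ w ] T (E G v w)) ×
  (∀ v w → T (E G v w) →
     ∃[ u ] ((T (E G v u) × T (E G w u)) ×
             (∀ u' → T (E G v u') → T (E G w u') → u' ≡ u)))

-- Triangles of G, represented canonically by their vertices a < b < c.
record Triangle {n : ℕ} (G : FinGraph n) : Set where
  constructor tri
  field
    a b c : Fin n
    a<b : a < b
    b<c : b < c
    ab : T (E G a b)
    bc : T (E G b c)
    ac : T (E G a c)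
open Triangle public

_∈Tri_ : ∀ {n} {G : FinGraph n} → Fin n → Triangle G → Set
x ∈Tri t = x ≡ a t ⊎ x ≡ b t ⊎ x ≡ c t

TriangleGraph : FiniteGraph → Graph
TriangleGraph (n , G) = record
  { V = Triangle G
  ; _~_ = λ s t → s ≢ t × ∃[ x ] (x ∈Tri s × x ∈Tri t)
  }

-- K4 - e on Fin 4: all pairs adjacent except {2,3} (and no loops).
K4-e : Fin 4 → Fin 4 → Bool
K4-e zero zero = false
K4-e zero _ = true
K4-e (suc zero) (suc zero) = false
K4-e (suc zero) _ = true
K4-e (suc (suc zero)) zero = true
K4-e (suc (suc zero)) (suc zero) = true
K4-e (suc (suc zero)) _ = false
K4-e (suc (suc (suc zero))) zero = true
K4-e (suc (suc (suc zero))) (suc zero) = true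
K4-e (suc (suc (suc zero))) _ = false

K1,4 : Fin 5 → Fin 5 → Bool
K1,4 zero zero = false
K1,4 zero (suc _) = true
K1,4 (suc _) zero = true
K1,4 (suc _) (suc _) = false

HasInduced : ∀ {n} → (k : ℕ) → (Fin k → Fin k → Bool) → FinGraph n → Set
HasInduced k P H =
  ∃[ f ] (Injective _≡_ _≡_ f × (∀ i j → E H (f i) (f j) ≡ P i j))

module Submission where

-- Record a locally linear G with G* ≅ H by its triangles: for each vertex v of H a line of three points
-- of G. Two lines meet, in exactly one point, iff their vertices are adjacent in H; every triangle of G
-- lies on a line; and G is the collinearity graph of the lines, since each edge lies in a unique triangle.
-- Conversely the collinearity graph of any such system of lines is locally linear with triangle graph H.
-- Uniqueness: a point on two lines is determined by H as their intersection, so two systems of lines are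
-- matched line by line, the points lying on one line only being paired arbitrarily.
-- Existence: without an induced K4 - e the neighbourhood of v is a disjoint union of cliques, without an
-- induced K1,4 there are at most three of them, and they index the points of the line of v; the point of
-- v for the clique containing w is identified with the point of w for the clique containing v.

open import Defs hiding (sym)
open import Data.Bool using (Bool; true; false; T)
import Data.Bool.Properties as Bool
open import Data.Empty using (⊥-elim)
open import Data.Fin using (Fin; zero; suc; punchIn; punchOut; combine; remQuot)
  renaming (_<_ to _<ᶠ_; _≤_ to _≤ᶠ_)
open import Data.Fin.Permutation
  using (Permutation′; _⟨$⟩ʳ_; _⟨$⟩ˡ_; id; insert; insert-punchIn; inverseˡ; inverseʳ)
open import Data.Fin.Properties
  using (_≟_; any?; all?; ¬∀⟶∃¬; <-cmp; <⇒≢; <-irrelevant; suc-injective; punchIn-injective;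
         punchIn-punchOut; punchInᵢ≢i; injective⇒≤; remQuot-combine; combine-remQuot)
open import Data.Nat using (ℕ; zero; suc; s≤s)
import Data.Nat.Properties as ℕ
open import Data.Product using (Σ-syntax; ∃; ∃-syntax; _×_; _,_; proj₁; proj₂; uncurry)
open import Data.Sum using (_⊎_; inj₁; inj₂)
open import Data.Vec.Functional using (_∷_; [])
open import Function using (_∘_; _⇔_; Equivalence; Inverse; mk⇔; mk↔ₛ′)
open import Function.Construct.Composition using (_↔-∘_; _⇔-∘_)
open import Function.Construct.Identity using (↔-id)
open import Function.Definitions using (Injective)
open import Level using (Level)
open import Relation.Binary using (Rel; IsDecEquivalence; tri<; tri≈; tri>)
open import Relation.Binary.PropositionalEquality
  using (_≡_; _≢_; refl; sym; trans; cong; subst; subst₂; module ≡-Reasoning)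
open import Relation.Nullary using (¬_; Dec; yes; no; ¬?; contradiction)
open import Relation.Nullary.Decidable
  using (T?; isYes; isYes≗does; does-⇔; dec-false; toWitness; fromWitness; from-yes;
         _×-dec_; _⊎-dec_; decidable-stable)
open import Relation.Unary using (Pred; Decidable)

private
  variable
    ℓ : Level
    k N : ℕ

record FinQuotient (_≈_ : Rel (Fin N) ℓ) : Set ℓ where
  field
    size             : ℕ
    class            : Fin N → Fin size
    class-sound      : ∀ {i j} → class i ≡ class j → i ≈ j
    class-complete   : ∀ {i j} → i ≈ j → class i ≡ class j
    class-surjective : ∀ y → ∃[ i ] class i ≡ y

finQuotient : {_≈_ : Rel (Fin N) ℓ} → IsDecEquivalence _≈_ → FinQuotient _≈_
finQuotient {N = zero} _ = record
  { size = 0 ; class = λ () ; class-sound = λ { {()} } ; class-complete = λ { {()} }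
  ; class-surjective = λ () }
finQuotient {N = suc N} {_≈_ = _≈_} isDecEq = extend (any? (λ j → zero ≈.≟ suc j))
  where
  module ≈ = IsDecEquivalence isDecEq
  rest : FinQuotient (λ i j → suc i ≈ suc j)
  rest = finQuotient (record
    { isEquivalence = record { refl = ≈.refl ; sym = ≈.sym ; trans = ≈.trans }
    ; _≟_ = λ i j → suc i ≈.≟ suc j })
  open FinQuotient rest

  extend : Dec (∃[ j ] zero ≈ suc j) → FinQuotient _≈_
  extend (yes (j , 0≈j)) = record
    { size = size ; class = class′ ; class-sound = sound ; class-complete = complete
    ; class-surjective = λ y → let (i , e) = class-surjective y in suc i , e }
    where
    class′ : Fin (suc N) → Fin size
    class′ zero = class j
    class′ (suc i) = class i
    sound : ∀ {i i′} → class′ i ≡ class′ i′ → i ≈ i′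
    sound {zero} {zero} _ = ≈.refl
    sound {zero} {suc i′} e = ≈.trans 0≈j (class-sound e)
    sound {suc i} {zero} e = ≈.sym (≈.trans 0≈j (class-sound (sym e)))
    sound {suc i} {suc i′} e = class-sound e
    complete : ∀ {i i′} → i ≈ i′ → class′ i ≡ class′ i′
    complete {zero} {zero} _ = refl
    complete {zero} {suc i′} r = class-complete (≈.trans (≈.sym 0≈j) r)
    complete {suc i} {zero} r = sym (class-complete (≈.trans (≈.sym 0≈j) (≈.sym r)))
    complete {suc i} {suc i′} r = class-complete r
  extend (no 0≉) = record
    { size = suc size ; class = class′ ; class-sound = sound ; class-complete = complete
    ; class-surjective = surjective }
    where
    class′ : Fin (suc N) → Fin (suc size)
    class′ zero = zero
    class′ (suc i) = suc (class i)
    sound : ∀ {i i′} → class′ i ≡ class′ i′ → i ≈ i′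
    sound {zero} {zero} _ = ≈.refl
    sound {suc i} {suc i′} e = class-sound (suc-injective e)
    complete : ∀ {i i′} → i ≈ i′ → class′ i ≡ class′ i′
    complete {zero} {zero} _ = refl
    complete {zero} {suc i′} r = ⊥-elim (0≉ (i′ , r))
    complete {suc i} {zero} r = ⊥-elim (0≉ (i , ≈.sym r))
    complete {suc i} {suc i′} r = cong suc (class-complete r)
    surjective : ∀ y → ∃[ i ] class′ i ≡ y
    surjective zero = zero , refl
    surjective (suc y) = let (i , e) = class-surjective y in suc i , cong suc e

record IsMatching (R : Fin k → Fin k → Set) : Set where
  field
    functional : ∀ {i j j′} → R i j → R i j′ → j ≡ j′
    injective  : ∀ {i i′ j} → R i j → R i′ j → i ≡ i′
    decidable  : ∀ i j → Dec (R i j)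

module _ {R : Fin (suc k) → Fin (suc k) → Set} (M : IsMatching R) where

  open IsMatching M

  -- Pigeonhole: the targets of 1, …, k cannot cover all of Fin (suc k).
  unmatched-target : ¬ ∃ (R zero) → ∃[ j ] ∀ i → ¬ R i j
  unmatched-target unmatched₀ with any? (λ j → all? (λ i → ¬? (decidable i j)))
  ... | yes free = free
  ... | no none = contradiction (injective⇒≤ source-injective) ℕ.1+n≰n
    where
    source : ∀ j → ∃[ i ] R (suc i) j
    source j with any? (λ i → decidable i j)
    ... | yes (zero , r) = ⊥-elim (unmatched₀ (j , r))
    ... | yes (suc i , r) = i , r
    ... | no ¬r = ⊥-elim (none (j , λ i r → ¬r (i , r)))
    source-injective : Injective _≡_ _≡_ (proj₁ ∘ source)
    source-injective {j} {j′} e =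
      functional (proj₂ (source j)) (subst (λ i → R (suc i) j′) (sym e) (proj₂ (source j′)))

-- Opaque: only the specification is used, and unfolding the recursion slows type checking down badly.
opaque
  extend-to-permutation : {R : Fin k → Fin k → Set} → IsMatching R →
                          Σ[ π ∈ Permutation′ k ] (∀ {i j} → R i j → π ⟨$⟩ʳ i ≡ j)
  extend-to-permutation {zero} M = id , λ { {()} }
  extend-to-permutation {suc k} {R} M = insert zero j₀ π′ , extends
    where
    open IsMatching M
    pivot : Σ[ j₀ ∈ Fin (suc k) ] ((∀ {j} → R zero j → j ≡ j₀) × (∀ {i j} → R (suc i) j → j₀ ≢ j))
    pivot with any? (decidable zero)
    ... | yes (j₀ , r₀) = j₀ , (λ r → functional r r₀) , λ { r refl → contradiction (injective r₀ r) λ () }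
    ... | no unmatched₀ with j₀ , free ← unmatched-target M unmatched₀ =
      j₀ , (λ r → ⊥-elim (unmatched₀ (_ , r))) , λ { {i} r refl → free (suc i) r }
    j₀ : Fin (suc k)
    j₀ = proj₁ pivot
    R′ : Fin k → Fin k → Set
    R′ i j = R (suc i) (punchIn j₀ j)
    π′-extends : Σ[ π′ ∈ Permutation′ k ] (∀ {i j} → R′ i j → π′ ⟨$⟩ʳ i ≡ j)
    π′-extends = extend-to-permutation {R = R′} (record
      { functional = λ r r′ → punchIn-injective j₀ _ _ (functional r r′)
      ; injective = λ r r′ → suc-injective (injective r r′)
      ; decidable = λ i j → decidable (suc i) (punchIn j₀ j) })
    π′ : Permutation′ k
    π′ = proj₁ π′-extends
    open ≡-Reasoning
    extends : ∀ {i j} → R i j → insert zero j₀ π′ ⟨$⟩ʳ i ≡ j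
    extends {zero} r = sym (proj₁ (proj₂ pivot) r)
    extends {suc i} {j} r = begin
      insert zero j₀ π′ ⟨$⟩ʳ suc i ≡⟨ insert-punchIn zero j₀ π′ i ⟩
      punchIn j₀ (π′ ⟨$⟩ʳ i)       ≡⟨ cong (punchIn j₀) (proj₂ π′-extends r′) ⟩
      punchIn j₀ (punchOut j₀≢j)   ≡⟨ punchIn-punchOut j₀≢j ⟩
      j                            ∎
      where
      j₀≢j : j₀ ≢ j
      j₀≢j = proj₂ (proj₂ pivot) r
      r′ : R′ i (punchOut j₀≢j)
      r′ = subst (R (suc i)) (sym (punchIn-punchOut j₀≢j)) r

-- Junk value: the last index when no index satisfies P.
firstIndex : {P : Pred (Fin (suc k)) ℓ} → Decidable P → Fin (suc k)
firstIndex {zero} P? = zero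
firstIndex {suc k} P? with P? zero
... | yes _ = zero
... | no _ = suc (firstIndex (P? ∘ suc))

firstIndex-satisfies : {P : Pred (Fin (suc k)) ℓ} (P? : Decidable P) → ∃ P → P (firstIndex P?)
firstIndex-satisfies {zero} P? (zero , p) = p
firstIndex-satisfies {suc k} P? (i , p) with P? zero | i
... | yes p₀ | _ = p₀
... | no ¬p₀ | zero = contradiction p ¬p₀
... | no _ | suc i = firstIndex-satisfies (P? ∘ suc) (i , p)

firstIndex-cong : {P Q : Pred (Fin (suc k)) ℓ} (P? : Decidable P) (Q? : Decidable Q) →
                  (∀ i → P i ⇔ Q i) → firstIndex P? ≡ firstIndex Q?
firstIndex-cong {zero} P? Q? P⇔Q = refl
firstIndex-cong {suc k} P? Q? P⇔Q with P? zero | Q? zero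
... | yes _ | yes _ = refl
... | yes p | no ¬q = contradiction (Equivalence.to (P⇔Q zero) p) ¬q
... | no ¬p | yes q = contradiction (Equivalence.from (P⇔Q zero) q) ¬p
... | no _ | no _ = cong suc (firstIndex-cong (P? ∘ suc) (Q? ∘ suc) (P⇔Q ∘ suc))

third : (i j : Fin 3) → i ≢ j →
        ∃[ k ] (k ≢ i × k ≢ j × ∀ l → l ≡ i ⊎ l ≡ j ⊎ l ≡ k)
third zero zero i≢j = contradiction refl i≢j
third zero (suc zero) _ = suc (suc zero) , (λ ()) , (λ ()) ,
  λ { zero → inj₁ refl ; (suc zero) → inj₂ (inj₁ refl) ; (suc (suc zero)) → inj₂ (inj₂ refl) }
third zero (suc (suc zero)) _ = suc zero , (λ ()) , (λ ()) ,
  λ { zero → inj₁ refl ; (suc zero) → inj₂ (inj₂ refl) ; (suc (suc zero)) → inj₂ (inj₁ refl) }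
third (suc zero) zero _ = suc (suc zero) , (λ ()) , (λ ()) ,
  λ { zero → inj₂ (inj₁ refl) ; (suc zero) → inj₁ refl ; (suc (suc zero)) → inj₂ (inj₂ refl) }
third (suc zero) (suc zero) i≢j = contradiction refl i≢j
third (suc zero) (suc (suc zero)) _ = zero , (λ ()) , (λ ()) ,
  λ { zero → inj₂ (inj₂ refl) ; (suc zero) → inj₁ refl ; (suc (suc zero)) → inj₂ (inj₁ refl) }
third (suc (suc zero)) zero _ = suc zero , (λ ()) , (λ ()) ,
  λ { zero → inj₂ (inj₁ refl) ; (suc zero) → inj₂ (inj₂ refl) ; (suc (suc zero)) → inj₁ refl }
third (suc (suc zero)) (suc zero) _ = zero , (λ ()) , (λ ()) ,
  λ { zero → inj₂ (inj₂ refl) ; (suc zero) → inj₂ (inj₁ refl) ; (suc (suc zero)) → inj₁ refl }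
third (suc (suc zero)) (suc (suc zero)) i≢j = contradiction refl i≢j

_∈₃_ : {A : Set} → A → (Fin 3 → A) → Set
x ∈₃ f = ∃[ i ] f i ≡ x

third-point : {A : Set} {f : Fin 3 → A} {x y : A} → Injective _≡_ _≡_ f →
              x ∈₃ f → y ∈₃ f → x ≢ y →
              ∃[ z ] (z ∈₃ f × z ≢ x × z ≢ y × ∀ w → w ∈₃ f → w ≡ x ⊎ w ≡ y ⊎ w ≡ z)
third-point {f = f} f-inj (i , i↦x) (j , j↦y) x≢y
  with k , k≢i , k≢j , exhaustive ← third i j (λ i≡j → x≢y (trans (sym i↦x) (trans (cong f i≡j) j↦y))) =
  f k , (k , refl) , (λ k↦x → k≢i (f-inj (trans k↦x (sym i↦x)))) ,
  (λ k↦y → k≢j (f-inj (trans k↦y (sym j↦y)))) , points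
  where
  points : ∀ w → w ∈₃ f → w ≡ _ ⊎ w ≡ _ ⊎ w ≡ f k
  points w (l , l↦w) with exhaustive l
  ... | inj₁ refl = inj₁ (trans (sym l↦w) i↦x)
  ... | inj₂ (inj₁ refl) = inj₂ (inj₁ (trans (sym l↦w) j↦y))
  ... | inj₂ (inj₂ refl) = inj₂ (inj₂ (sym l↦w))

≅-trans : {G₁ G₂ G₃ : Graph} → G₁ ≅ G₂ → G₂ ≅ G₃ → G₁ ≅ G₃
≅-trans φ ψ = record
  { bij = _≅_.bij ψ ↔-∘ _≅_.bij φ
  ; pres = λ x y → _≅_.pres ψ _ _ ⇔-∘ _≅_.pres φ x y
  }

≅-of-⇔ : {V : Set} {R S : V → V → Set} → (∀ {x y} → R x y → S x y) → (∀ {x y} → S x y → R x y) →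
         record { V = V ; _~_ = R } ≅ record { V = V ; _~_ = S }
≅-of-⇔ R⇒S S⇒R = record { bij = ↔-id _ ; pres = λ _ _ → mk⇔ R⇒S S⇒R }

module _ {m : ℕ} {R : Fin m → Fin m → Set} (R? : ∀ x y → Dec (R x y))
         (R-sym : ∀ {x y} → R x y → R y x) (R-irrefl : ∀ {x} → ¬ R x x) where

  relationGraph : FinGraph m
  relationGraph = record
    { E = λ x y → isYes (R? x y)
    ; sym = λ x y → trans (isYes≗does (R? x y))
                      (trans (does-⇔ (mk⇔ R-sym R-sym) (R? x y) (R? y x)) (sym (isYes≗does (R? y x))))
    ; irrefl = λ x → trans (isYes≗does (R? x x)) (dec-false (R? x x) R-irrefl)
    }

module TriangleProperties {m : ℕ} (G : FinGraph m) where

  Adj : Fin m → Fin m → Set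
  Adj x y = T (E G x y)

  adj-sym : ∀ {x y} → Adj x y → Adj y x
  adj-sym {x} {y} = subst T (FinGraph.sym G x y)

  adj⇒≢ : ∀ {x y} → Adj x y → x ≢ y
  adj⇒≢ {x} xy refl = subst T (irrefl G x) xy

  corner : Triangle G → Fin 3 → Fin m
  corner t zero = a t
  corner t (suc zero) = b t
  corner t (suc (suc zero)) = c t

  corner-∈Tri : ∀ t i → corner t i ∈Tri t
  corner-∈Tri t zero = inj₁ refl
  corner-∈Tri t (suc zero) = inj₂ (inj₁ refl)
  corner-∈Tri t (suc (suc zero)) = inj₂ (inj₂ refl)

  ∈Tri⇒corner : ∀ (t : Triangle G) {x} → x ∈Tri t → x ∈₃ corner t
  ∈Tri⇒corner t (inj₁ refl) = zero , refl
  ∈Tri⇒corner t (inj₂ (inj₁ refl)) = suc zero , refl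
  ∈Tri⇒corner t (inj₂ (inj₂ refl)) = suc (suc zero) , refl

  corner⇒∈Tri : ∀ (t : Triangle G) {x} → x ∈₃ corner t → x ∈Tri t
  corner⇒∈Tri t (i , refl) = corner-∈Tri t i

  corners-adjacent : ∀ t {i j} → i ≢ j → Adj (corner t i) (corner t j)
  corners-adjacent t {zero} {zero} i≢j = contradiction refl i≢j
  corners-adjacent t {zero} {suc zero} _ = ab t
  corners-adjacent t {zero} {suc (suc zero)} _ = ac t
  corners-adjacent t {suc zero} {zero} _ = adj-sym (ab t)
  corners-adjacent t {suc zero} {suc zero} i≢j = contradiction refl i≢j
  corners-adjacent t {suc zero} {suc (suc zero)} _ = bc t
  corners-adjacent t {suc (suc zero)} {zero} _ = adj-sym (ac t)
  corners-adjacent t {suc (suc zero)} {suc zero} _ = adj-sym (bc t)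
  corners-adjacent t {suc (suc zero)} {suc (suc zero)} i≢j = contradiction refl i≢j

  corner-injective : ∀ t → Injective _≡_ _≡_ (corner t)
  corner-injective t {i} {j} e with i ≟ j
  ... | yes i≡j = i≡j
  ... | no i≢j = contradiction e (adj⇒≢ (corners-adjacent t i≢j))

  ∈Tri-adjacent : ∀ (t : Triangle G) {x y} → x ∈Tri t → y ∈Tri t → x ≢ y → Adj x y
  ∈Tri-adjacent t x∈t y∈t x≢y =
    let i , i↦x = ∈Tri⇒corner t x∈t
        j , j↦y = ∈Tri⇒corner t y∈t
    in subst₂ Adj i↦x j↦y
         (corners-adjacent t {i} {j} λ i≡j → x≢y (trans (sym i↦x) (trans (cong (corner t) i≡j) j↦y)))

  third-vertex : ∀ (t : Triangle G) {x y} → x ∈Tri t → y ∈Tri t → x ≢ y →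
                 ∃[ z ] (z ∈Tri t × z ≢ x × z ≢ y × ∀ w → w ∈Tri t → w ≡ x ⊎ w ≡ y ⊎ w ≡ z)
  third-vertex t x∈t y∈t x≢y
    with z , z∈t , z≢x , z≢y , vertices ←
         third-point (corner-injective t) (∈Tri⇒corner t x∈t) (∈Tri⇒corner t y∈t) x≢y =
    z , corner⇒∈Tri t z∈t , z≢x , z≢y , λ w w∈t → vertices w (∈Tri⇒corner t w∈t)

  ∈Tri⇒a≤ : ∀ (t : Triangle G) {x} → x ∈Tri t → a t ≤ᶠ x
  ∈Tri⇒a≤ t (inj₁ refl) = ℕ.≤-refl
  ∈Tri⇒a≤ t (inj₂ (inj₁ refl)) = ℕ.<⇒≤ (a<b t)
  ∈Tri⇒a≤ t (inj₂ (inj₂ refl)) = ℕ.<⇒≤ (ℕ.<-trans (a<b t) (b<c t))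

  ∈Tri⇒≤c : ∀ (t : Triangle G) {x} → x ∈Tri t → x ≤ᶠ c t
  ∈Tri⇒≤c t (inj₁ refl) = ℕ.<⇒≤ (ℕ.<-trans (a<b t) (b<c t))
  ∈Tri⇒≤c t (inj₂ (inj₁ refl)) = ℕ.<⇒≤ (b<c t)
  ∈Tri⇒≤c t (inj₂ (inj₂ refl)) = ℕ.≤-refl

  triangle-≡-corners : ∀ {s t : Triangle G} → a s ≡ a t → b s ≡ b t → c s ≡ c t → s ≡ t
  triangle-≡-corners {tri _ _ _ a<b b<c ab bc ac} {tri _ _ _ a<b′ b<c′ ab′ bc′ ac′} refl refl refl
    rewrite <-irrelevant a<b a<b′ | <-irrelevant b<c b<c′
          | Bool.T-irrelevant ab ab′ | Bool.T-irrelevant bc bc′ | Bool.T-irrelevant ac ac′ = refl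

  -- Both triangles list three vertices in increasing order: the middle ones must agree, then the extreme ones.
  triangle-≡ : ∀ (s t : Triangle G) → (∀ x → x ∈Tri s → x ∈Tri t) → s ≡ t
  triangle-≡ s t s⊆t = triangle-≡-corners a≡ b≡ c≡
    where
    at≤as = ∈Tri⇒a≤ t (s⊆t (a s) (inj₁ refl))
    cs≤ct = ∈Tri⇒≤c t (s⊆t (c s) (inj₂ (inj₂ refl)))
    b≡ : b s ≡ b t
    b≡ with s⊆t (b s) (inj₂ (inj₁ refl))
    ... | inj₁ bs≡at = contradiction (sym bs≡at) (<⇒≢ (ℕ.≤-<-trans at≤as (a<b s)))
    ... | inj₂ (inj₁ bs≡bt) = bs≡bt
    ... | inj₂ (inj₂ bs≡ct) = contradiction bs≡ct (<⇒≢ (ℕ.<-≤-trans (b<c s) cs≤ct))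
    a≡ : a s ≡ a t
    a≡ with s⊆t (a s) (inj₁ refl)
    ... | inj₁ as≡at = as≡at
    ... | inj₂ (inj₁ as≡bt) = contradiction (trans as≡bt (sym b≡)) (<⇒≢ (a<b s))
    ... | inj₂ (inj₂ as≡ct) = contradiction as≡ct (<⇒≢ (ℕ.<-≤-trans (ℕ.<-trans (a<b s) (b<c s)) cs≤ct))
    c≡ : c s ≡ c t
    c≡ with s⊆t (c s) (inj₂ (inj₂ refl))
    ... | inj₁ cs≡at = contradiction (sym cs≡at) (<⇒≢ (ℕ.≤-<-trans at≤as (ℕ.<-trans (a<b s) (b<c s))))
    ... | inj₂ (inj₁ cs≡bt) = contradiction (trans b≡ (sym cs≡bt)) (<⇒≢ (b<c s))
    ... | inj₂ (inj₂ cs≡ct) = cs≡ct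

  private
    insertThird : ∀ {x y z} → x <ᶠ y → Adj x y → Adj x z → Adj y z →
                  Σ[ t ∈ Triangle G ] (x ∈Tri t × y ∈Tri t × z ∈Tri t)
    insertThird {x} {y} {z} x<y xy xz yz with <-cmp z x
    ... | tri< z<x _ _ = tri z x y z<x x<y (adj-sym xz) xy (adj-sym yz) ,
                         inj₂ (inj₁ refl) , inj₂ (inj₂ refl) , inj₁ refl
    ... | tri≈ _ z≡x _ = contradiction (sym z≡x) (adj⇒≢ xz)
    ... | tri> _ _ x<z with <-cmp z y
    ...   | tri< z<y _ _ = tri x z y x<z z<y xz (adj-sym yz) xy ,
                           inj₁ refl , inj₂ (inj₂ refl) , inj₂ (inj₁ refl)
    ...   | tri≈ _ z≡y _ = contradiction (sym z≡y) (adj⇒≢ yz)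
    ...   | tri> _ _ y<z = tri x y z x<y y<z xy yz xz ,
                           inj₁ refl , inj₂ (inj₁ refl) , inj₂ (inj₂ refl)

  triangleThrough : ∀ {x y z} → Adj x y → Adj y z → Adj x z →
                    Σ[ t ∈ Triangle G ] (x ∈Tri t × y ∈Tri t × z ∈Tri t)
  triangleThrough {x} {y} xy yz xz with <-cmp x y
  ... | tri< x<y _ _ = insertThird x<y xy xz yz
  ... | tri≈ _ x≡y _ = contradiction x≡y (adj⇒≢ xy)
  ... | tri> _ _ y<x with t , y∈t , x∈t , z∈t ← insertThird y<x (adj-sym xy) yz xz = t , x∈t , y∈t , z∈t

  module _ (ll : LocallyLinear (m , G)) where

    edge-in-triangle : ∀ {x y} → Adj x y → Σ[ t ∈ Triangle G ] (x ∈Tri t × y ∈Tri t)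
    edge-in-triangle {x} {y} xy with u , (xu , yu) , _ ← proj₂ ll x y xy
      with t , x∈t , y∈t , _ ← triangleThrough xy yu xu = t , x∈t , y∈t

    vertex-in-triangle : ∀ x → Σ[ t ∈ Triangle G ] x ∈Tri t
    vertex-in-triangle x with y , xy ← proj₁ ll x = proj₁ (edge-in-triangle xy) , proj₁ (proj₂ (edge-in-triangle xy))

    edge-in-unique-triangle : ∀ (s t : Triangle G) {x y} → x ≢ y →
                              x ∈Tri s → y ∈Tri s → x ∈Tri t → y ∈Tri t → s ≡ t
    edge-in-unique-triangle s t {x} {y} x≢y x∈s y∈s x∈t y∈t = triangle-≡ s t s⊆t
      where
      xy : Adj x y
      xy = ∈Tri-adjacent s x∈s y∈s x≢y
      u : Fin m
      u = proj₁ (proj₂ ll x y xy)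
      third-is-u : ∀ r → x ∈Tri r → y ∈Tri r → ∀ {z} → z ∈Tri r → z ≢ x → z ≢ y → z ≡ u
      third-is-u r x∈r y∈r z∈r z≢x z≢y = proj₂ (proj₂ (proj₂ ll x y xy)) _
        (∈Tri-adjacent r x∈r z∈r (z≢x ∘ sym)) (∈Tri-adjacent r y∈r z∈r (z≢y ∘ sym))
      s⊆t : ∀ w → w ∈Tri s → w ∈Tri t
      s⊆t w w∈s with third-vertex s x∈s y∈s x≢y | third-vertex t x∈t y∈t x≢y
      ... | z , z∈s , z≢x , z≢y , vertices | z′ , z′∈t , z′≢x , z′≢y , _ with vertices w w∈s
      ... | inj₁ refl = x∈t
      ... | inj₂ (inj₁ refl) = y∈t
      ... | inj₂ (inj₂ refl) =
        subst (_∈Tri t) (trans (third-is-u t x∈t y∈t z′∈t z′≢x z′≢y) (sym (third-is-u s x∈s y∈s z∈s z≢x z≢y))) z′∈t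

module Realisations {n : ℕ} (H : FinGraph n) where

  open TriangleProperties H using () renaming (Adj to Edge; adj⇒≢ to edge⇒≢)

  module _ {m : ℕ} (P : Fin n → Fin 3 → Fin m) where

    Collinear : Fin m → Fin m → Set
    Collinear x y = ∃[ v ] (x ∈₃ P v × y ∈₃ P v)

    Joined : Fin m → Fin m → Set
    Joined x y = x ≢ y × Collinear x y

    joined? : ∀ x y → Dec (Joined x y)
    joined? x y = ¬? (x ≟ y) ×-dec any? (λ v → any? (λ i → P v i ≟ x) ×-dec any? (λ i → P v i ≟ y))

    collinearityGraph : FinGraph m
    collinearityGraph = relationGraph joined?
      (λ (x≢y , v , x∈v , y∈v) → x≢y ∘ sym , v , y∈v , x∈v) (λ (x≢x , _) → x≢x refl)

    -- P v lists the vertices of the triangle of G that v ∈ V(H) stands for.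
    record IsRealisation : Set where
      field
        line-injective      : ∀ v → Injective _≡_ _≡_ (P v)
        adjacent⇒meet       : ∀ {v w} → Edge v w → ∃[ x ] (x ∈₃ P v × x ∈₃ P w)
        meet⇒adjacent       : ∀ {v w x} → v ≢ w → x ∈₃ P v → x ∈₃ P w → Edge v w
        meet-unique         : ∀ {v w x y} → v ≢ w → x ∈₃ P v → x ∈₃ P w → y ∈₃ P v → y ∈₃ P w → x ≡ y
        triangle-on-line    : ∀ {x y z} → x ≢ y → y ≢ z → x ≢ z →
                              Collinear x y → Collinear y z → Collinear x z →
                              ∃[ v ] (x ∈₃ P v × y ∈₃ P v × z ∈₃ P v)
        covered             : ∀ x → ∃[ v ] x ∈₃ P v

      line-unique : ∀ {v w x y} → x ≢ y → x ∈₃ P v → y ∈₃ P v → x ∈₃ P w → y ∈₃ P w → v ≡ w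
      line-unique {v} {w} x≢y x∈v y∈v x∈w y∈w with v ≟ w
      ... | yes v≡w = v≡w
      ... | no v≢w = contradiction (meet-unique v≢w x∈v x∈w y∈v y∈w) x≢y

      concurrent : ∀ {u v w x y z} → u ≢ v → u ≢ w →
                   x ∈₃ P u → x ∈₃ P v → y ∈₃ P u → y ∈₃ P w → z ∈₃ P v → z ∈₃ P w → x ≡ y
      concurrent {u} {v} {w} {x} {y} {z} u≢v u≢w x∈u x∈v y∈u y∈w z∈v z∈w with x ≟ y | x ≟ z | y ≟ z
      ... | yes x≡y | _ | _ = x≡y
      ... | no _ | yes refl | _ = meet-unique u≢w x∈u z∈w y∈u y∈w
      ... | no _ | no _ | yes refl = sym (meet-unique u≢v y∈u z∈v x∈u x∈v)
      ... | no x≢y | no x≢z | no y≢z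
        with t , x∈t , y∈t , z∈t ← triangle-on-line x≢y y≢z x≢z (u , x∈u , y∈u) (w , y∈w , z∈w) (v , x∈v , z∈v)
        with refl ← line-unique x≢y x∈t y∈t x∈u y∈u
        = contradiction (line-unique x≢z x∈t z∈t x∈v z∈v) u≢v

  module FromRealisation {m : ℕ} {P : Fin n → Fin 3 → Fin m} (R : IsRealisation P) where

    open IsRealisation R
    open TriangleProperties (collinearityGraph P)

    adj⇒joined : ∀ {x y} → Adj x y → Joined P x y
    adj⇒joined = toWitness

    joined⇒adj : ∀ {x y} → Joined P x y → Adj x y
    joined⇒adj = fromWitness

    line-adjacent : ∀ v {i j} → i ≢ j → Adj (P v i) (P v j)
    line-adjacent v i≢j = joined⇒adj (i≢j ∘ line-injective v , v , (_ , refl) , (_ , refl))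

    locallyLinear : LocallyLinear (m , collinearityGraph P)
    locallyLinear = neighbour , commonNeighbour
      where
      neighbour : ∀ x → ∃[ y ] Adj x y
      neighbour x with v , i , refl ← covered x =
        P v (punchIn i zero) , line-adjacent v (punchInᵢ≢i i zero ∘ sym)
      commonNeighbour : ∀ x y → Adj x y →
        ∃[ u ] ((Adj x u × Adj y u) × (∀ u′ → Adj x u′ → Adj y u′ → u′ ≡ u))
      commonNeighbour x y xy
        with x≢y , v , x∈v , y∈v ← adj⇒joined xy
        with u , u∈v , u≢x , u≢y , points ← third-point (line-injective v) x∈v y∈v x≢y =
        u , (on-line x∈v u∈v (u≢x ∘ sym) , on-line y∈v u∈v (u≢y ∘ sym)) , unique
        where
        on-line : ∀ {x y} → x ∈₃ P v → y ∈₃ P v → x ≢ y → Adj x y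
        on-line x∈v y∈v x≢y = joined⇒adj (x≢y , v , x∈v , y∈v)
        unique : ∀ u′ → Adj x u′ → Adj y u′ → u′ ≡ u
        unique u′ xu′ yu′
          with x≢u′ , xu′-collinear ← adj⇒joined xu′ | y≢u′ , yu′-collinear ← adj⇒joined yu′
          with w , x∈w , y∈w , u′∈w ← triangle-on-line x≢y y≢u′ x≢u′ (v , x∈v , y∈v) yu′-collinear xu′-collinear
          with refl ← line-unique x≢y x∈w y∈w x∈v y∈v
          with points u′ u′∈w
        ... | inj₁ u′≡x = contradiction (sym u′≡x) x≢u′
        ... | inj₂ (inj₁ u′≡y) = contradiction (sym u′≡y) y≢u′
        ... | inj₂ (inj₂ u′≡u) = u′≡u

    lineThrough : ∀ (t : Triangle (collinearityGraph P)) → ∃[ v ] (a t ∈₃ P v × b t ∈₃ P v × c t ∈₃ P v)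
    lineThrough t
      with a≢b , ab-collinear ← adj⇒joined (ab t)
         | b≢c , bc-collinear ← adj⇒joined (bc t)
         | a≢c , ac-collinear ← adj⇒joined (ac t) =
      triangle-on-line a≢b b≢c a≢c ab-collinear bc-collinear ac-collinear

    lineOf : Triangle (collinearityGraph P) → Fin n
    lineOf t = proj₁ (lineThrough t)

    ∈Tri⇒∈lineOf : ∀ (t : Triangle (collinearityGraph P)) {x} → x ∈Tri t → x ∈₃ P (lineOf t)
    ∈Tri⇒∈lineOf t (inj₁ refl) = proj₁ (proj₂ (lineThrough t))
    ∈Tri⇒∈lineOf t (inj₂ (inj₁ refl)) = proj₁ (proj₂ (proj₂ (lineThrough t)))
    ∈Tri⇒∈lineOf t (inj₂ (inj₂ refl)) = proj₂ (proj₂ (proj₂ (lineThrough t)))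

    triangleThroughLine : ∀ v → Σ[ t ∈ Triangle (collinearityGraph P) ]
                            (P v zero ∈Tri t × P v (suc zero) ∈Tri t × P v (suc (suc zero)) ∈Tri t)
    triangleThroughLine v = triangleThrough (line-adjacent v λ ()) (line-adjacent v λ ()) (line-adjacent v λ ())

    triangleOf : Fin n → Triangle (collinearityGraph P)
    triangleOf v = proj₁ (triangleThroughLine v)

    ∈line⇒∈triangleOf : ∀ v {x} → x ∈₃ P v → x ∈Tri triangleOf v
    ∈line⇒∈triangleOf v (zero , refl) = proj₁ (proj₂ (triangleThroughLine v))
    ∈line⇒∈triangleOf v (suc zero , refl) = proj₁ (proj₂ (proj₂ (triangleThroughLine v)))
    ∈line⇒∈triangleOf v (suc (suc zero) , refl) = proj₂ (proj₂ (proj₂ (triangleThroughLine v)))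

    lineOf-triangleOf : ∀ v → lineOf (triangleOf v) ≡ v
    lineOf-triangleOf v = line-unique (λ e → 0≢1 (line-injective v e))
      (on-lineOf (zero , refl)) (on-lineOf (suc zero , refl)) (zero , refl) (suc zero , refl)
      where
      0≢1 : zero ≢ suc zero
      0≢1 ()
      on-lineOf : ∀ {x} → x ∈₃ P v → x ∈₃ P (lineOf (triangleOf v))
      on-lineOf = ∈Tri⇒∈lineOf (triangleOf v) ∘ ∈line⇒∈triangleOf v

    triangleOf-lineOf : ∀ (t : Triangle (collinearityGraph P)) → triangleOf (lineOf t) ≡ t
    triangleOf-lineOf t =
      sym (triangle-≡ t (triangleOf (lineOf t)) λ x → ∈line⇒∈triangleOf (lineOf t) ∘ ∈Tri⇒∈lineOf t)

    ∈lineOf⇒∈Tri : ∀ (t : Triangle (collinearityGraph P)) {x} → x ∈₃ P (lineOf t) → x ∈Tri t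
    ∈lineOf⇒∈Tri t x∈ = subst (_ ∈Tri_) (triangleOf-lineOf t) (∈line⇒∈triangleOf (lineOf t) x∈)

    triangleGraph≅ : TriangleGraph (m , collinearityGraph P) ≅ ⟦ (n , H) ⟧
    triangleGraph≅ = record
      { bij = mk↔ₛ′ lineOf triangleOf lineOf-triangleOf triangleOf-lineOf
      ; pres = λ s t → mk⇔ (share⇒edge s t) (edge⇒share s t)
      }
      where
      share⇒edge : ∀ (s t : Triangle (collinearityGraph P)) →
                   s ≢ t × ∃[ x ] (x ∈Tri s × x ∈Tri t) → Edge (lineOf s) (lineOf t)
      share⇒edge s t (s≢t , x , x∈s , x∈t) = meet⇒adjacent
        (λ e → s≢t (trans (sym (triangleOf-lineOf s)) (trans (cong triangleOf e) (triangleOf-lineOf t))))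
        (∈Tri⇒∈lineOf s x∈s) (∈Tri⇒∈lineOf t x∈t)
      edge⇒share : ∀ (s t : Triangle (collinearityGraph P)) →
                   Edge (lineOf s) (lineOf t) → s ≢ t × ∃[ x ] (x ∈Tri s × x ∈Tri t)
      edge⇒share s t e with x , x∈s , x∈t ← adjacent⇒meet e =
        (edge⇒≢ e ∘ cong lineOf) , x , ∈lineOf⇒∈Tri s x∈s , ∈lineOf⇒∈Tri t x∈t

module FromLocallyLinear {n : ℕ} (H : FinGraph n) {m : ℕ} (G : FinGraph m)
  (ll : LocallyLinear (m , G)) (ψ : TriangleGraph (m , G) ≅ ⟦ (n , H) ⟧) where

  open Realisations H
  open TriangleProperties H using () renaming (Adj to Edge)
  open TriangleProperties G
  open Inverse (_≅_.bij ψ) using (to; from; strictlyInverseˡ; strictlyInverseʳ)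

  line : Fin n → Fin 3 → Fin m
  line v = corner (from v)

  from-injective : ∀ {v w} → from v ≡ from w → v ≡ w
  from-injective {v} {w} e = trans (sym (strictlyInverseˡ v)) (trans (cong to e) (strictlyInverseˡ w))

  ∈Tri⇒∈line : ∀ t {x} → x ∈Tri t → x ∈₃ line (to t)
  ∈Tri⇒∈line t x∈t = ∈Tri⇒corner (from (to t)) (subst (_ ∈Tri_) (sym (strictlyInverseʳ t)) x∈t)

  collinear⇒adj : ∀ {x y} → x ≢ y → Collinear line x y → Adj x y
  collinear⇒adj x≢y (v , x∈v , y∈v) =
    ∈Tri-adjacent (from v) (corner⇒∈Tri (from v) x∈v) (corner⇒∈Tri (from v) y∈v) x≢y

  adj⇒joined : ∀ {x y} → Adj x y → Joined line x y
  adj⇒joined xy with t , x∈t , y∈t ← edge-in-triangle ll xy =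
    adj⇒≢ xy , to t , ∈Tri⇒∈line t x∈t , ∈Tri⇒∈line t y∈t

  ≅collinearityGraph : ⟦ (m , G) ⟧ ≅ ⟦ (m , collinearityGraph line) ⟧
  ≅collinearityGraph = ≅-of-⇔ (fromWitness ∘ adj⇒joined) (uncurry collinear⇒adj ∘ toWitness)

  collinearityGraph≅ : ⟦ (m , collinearityGraph line) ⟧ ≅ ⟦ (m , G) ⟧
  collinearityGraph≅ = ≅-of-⇔ (uncurry collinear⇒adj ∘ toWitness) (fromWitness ∘ adj⇒joined)

  isRealisation : IsRealisation line
  isRealisation = record
    { line-injective = corner-injective ∘ from
    ; adjacent⇒meet = adjacent⇒meet
    ; meet⇒adjacent = meet⇒adjacent
    ; meet-unique = meet-unique
    ; triangle-on-line = triangle-on-line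
    ; covered = covered
    }
    where
    adjacent⇒meet : ∀ {v w} → Edge v w → ∃[ x ] (x ∈₃ line v × x ∈₃ line w)
    adjacent⇒meet {v} {w} e
      with _ , x , x∈v , x∈w ← Equivalence.from (_≅_.pres ψ (from v) (from w))
                                  (subst₂ Edge (sym (strictlyInverseˡ v)) (sym (strictlyInverseˡ w)) e) =
      x , ∈Tri⇒corner (from v) x∈v , ∈Tri⇒corner (from w) x∈w
    meet⇒adjacent : ∀ {v w x} → v ≢ w → x ∈₃ line v → x ∈₃ line w → Edge v w
    meet⇒adjacent {v} {w} {x} v≢w x∈v x∈w = subst₂ Edge (strictlyInverseˡ v) (strictlyInverseˡ w)
      (Equivalence.to (_≅_.pres ψ (from v) (from w))
        (v≢w ∘ from-injective , x , corner⇒∈Tri (from v) x∈v , corner⇒∈Tri (from w) x∈w))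
    meet-unique : ∀ {v w x y} → v ≢ w → x ∈₃ line v → x ∈₃ line w → y ∈₃ line v → y ∈₃ line w → x ≡ y
    meet-unique {v} {w} {x} {y} v≢w x∈v x∈w y∈v y∈w with x ≟ y
    ... | yes x≡y = x≡y
    ... | no x≢y = contradiction (from-injective (edge-in-unique-triangle ll (from v) (from w) x≢y
        (corner⇒∈Tri (from v) x∈v) (corner⇒∈Tri (from v) y∈v)
        (corner⇒∈Tri (from w) x∈w) (corner⇒∈Tri (from w) y∈w))) v≢w
    triangle-on-line : ∀ {x y z} → x ≢ y → y ≢ z → x ≢ z →
                       Collinear line x y → Collinear line y z → Collinear line x z →
                       ∃[ v ] (x ∈₃ line v × y ∈₃ line v × z ∈₃ line v)
    triangle-on-line x≢y y≢z x≢z xy yz xz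
      with t , x∈t , y∈t , z∈t ←
           triangleThrough (collinear⇒adj x≢y xy) (collinear⇒adj y≢z yz) (collinear⇒adj x≢z xz) =
      to t , ∈Tri⇒∈line t x∈t , ∈Tri⇒∈line t y∈t , ∈Tri⇒∈line t z∈t
    covered : ∀ x → ∃[ v ] x ∈₃ line v
    covered x with t , x∈t ← vertex-in-triangle ll x = to t , ∈Tri⇒∈line t x∈t

module Uniqueness {n : ℕ} (H : FinGraph n) where

  open Realisations H
  open IsRealisation

  private
    variable
      mA mB : ℕ

  Corresponding : (PA : Fin n → Fin 3 → Fin mA) (PB : Fin n → Fin 3 → Fin mB) → Fin n → Fin 3 → Fin 3 → Set
  Corresponding PA PB v i j = ∃[ w ] (w ≢ v × PA v i ∈₃ PA w × PB v j ∈₃ PB w)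

  corresponding-swap : ∀ {PA : Fin n → Fin 3 → Fin mA} {PB : Fin n → Fin 3 → Fin mB} {v i j} →
                       Corresponding PA PB v i j → Corresponding PB PA v j i
  corresponding-swap (w , w≢v , i∈w , j∈w) = w , w≢v , j∈w , i∈w

  corresponding-functional : ∀ {PA : Fin n → Fin 3 → Fin mA} {PB : Fin n → Fin 3 → Fin mB} →
    IsRealisation PA → IsRealisation PB →
    ∀ {v i j j′} → Corresponding PA PB v i j → Corresponding PA PB v i j′ → j ≡ j′
  corresponding-functional A B {v} (w , w≢v , i∈w , j∈w) (w′ , w′≢v , i∈w′ , j′∈w′) with w ≟ w′
  ... | yes refl = line-injective B v (meet-unique B (w≢v ∘ sym) (_ , refl) j∈w (_ , refl) j′∈w′)
  ... | no w≢w′ with z , z∈w , z∈w′ ← adjacent⇒meet B (meet⇒adjacent A w≢w′ i∈w i∈w′) =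
    line-injective B v (concurrent B (w≢v ∘ sym) (w′≢v ∘ sym) (_ , refl) j∈w (_ , refl) j′∈w′ z∈w z∈w′)

  correspondence-matching : ∀ {PA : Fin n → Fin 3 → Fin mA} {PB : Fin n → Fin 3 → Fin mB} →
    IsRealisation PA → IsRealisation PB → ∀ v → IsMatching (Corresponding PA PB v)
  correspondence-matching {PA = PA} {PB} A B v = record
    { functional = corresponding-functional A B
    ; injective = λ r r′ → corresponding-functional B A (corresponding-swap r) (corresponding-swap r′)
    ; decidable = λ i j → any? λ w →
        ¬? (w ≟ v) ×-dec (any? λ k → PA w k ≟ PA v i) ×-dec (any? λ k → PB w k ≟ PB v j)
    }

  module Transfer {PA : Fin n → Fin 3 → Fin mA} {PB : Fin n → Fin 3 → Fin mB}
    (A : IsRealisation PA) (B : IsRealisation PB)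
    (σ : Fin n → Fin 3 → Fin 3) (σ-extends : ∀ {v i j} → Corresponding PA PB v i j → σ v i ≡ j) where

    transfer : Fin mA → Fin mB
    transfer x = let v , i , _ = covered A x in PB v (σ v i)

    -- Independent of the chosen line: a point on lines v₀ ≠ v goes to the common point of their B-lines.
    transfer-line : ∀ v i → transfer (PA v i) ≡ PB v (σ v i)
    transfer-line v i with covered A (PA v i)
    ... | v₀ , i₀ , i₀↦x with v₀ ≟ v
    ...   | yes refl = cong (PB v ∘ σ v) (line-injective A v i₀↦x)
    ...   | no v₀≢v
      with z , (j₀ , j₀↦z) , (j , j↦z) ← adjacent⇒meet B (meet⇒adjacent A v₀≢v (i₀ , i₀↦x) (i , refl)) =
      begin
        PB v₀ (σ v₀ i₀) ≡⟨ cong (PB v₀) (σ-extends (v , v₀≢v ∘ sym , (i , sym i₀↦x) , (j , trans j↦z (sym j₀↦z)))) ⟩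
        PB v₀ j₀        ≡⟨ trans j₀↦z (sym j↦z) ⟩
        PB v j          ≡⟨ cong (PB v) (sym (σ-extends (v₀ , v₀≢v , (i₀ , i₀↦x) , (j₀ , trans j₀↦z (sym j↦z))))) ⟩
        PB v (σ v i)    ∎
      where open ≡-Reasoning

    transfer-∈ : ∀ {v x} → x ∈₃ PA v → transfer x ∈₃ PB v
    transfer-∈ {v} (i , refl) = σ v i , sym (transfer-line v i)

    transfer-collinear : ∀ {x y} → Collinear PA x y → Collinear PB (transfer x) (transfer y)
    transfer-collinear (v , x∈v , y∈v) = v , transfer-∈ x∈v , transfer-∈ y∈v

  transfer-inverse : ∀ {PA : Fin n → Fin 3 → Fin mA} {PB : Fin n → Fin 3 → Fin mB}
    (A : IsRealisation PA) (B : IsRealisation PB) {σ τ : Fin n → Fin 3 → Fin 3}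
    (σ-extends : ∀ {v i j} → Corresponding PA PB v i j → σ v i ≡ j)
    (τ-extends : ∀ {v i j} → Corresponding PB PA v i j → τ v i ≡ j) →
    (∀ v i → τ v (σ v i) ≡ i) →
    ∀ x → Transfer.transfer B A τ τ-extends (Transfer.transfer A B σ σ-extends x) ≡ x
  transfer-inverse {PA = PA} {PB} A B {σ} {τ} σ-extends τ-extends τσ≡id x =
    let v , i , i↦x = covered A x in begin
      g (f x)            ≡⟨ cong (g ∘ f) (sym i↦x) ⟩
      g (f (PA v i))     ≡⟨ cong g (Transfer.transfer-line A B σ σ-extends v i) ⟩
      g (PB v (σ v i))   ≡⟨ Transfer.transfer-line B A τ τ-extends v (σ v i) ⟩
      PA v (τ v (σ v i)) ≡⟨ cong (PA v) (τσ≡id v i) ⟩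
      PA v i             ≡⟨ i↦x ⟩
      x                  ∎
    where
    open ≡-Reasoning
    f = Transfer.transfer A B σ σ-extends
    g = Transfer.transfer B A τ τ-extends

  realisations-isomorphic : ∀ {PA : Fin n → Fin 3 → Fin mA} {PB : Fin n → Fin 3 → Fin mB} →
    IsRealisation PA → IsRealisation PB → ⟦ (mA , collinearityGraph PA) ⟧ ≅ ⟦ (mB , collinearityGraph PB) ⟧
  realisations-isomorphic {mA} {mB} {PA} {PB} A B = record
    { bij = mk↔ₛ′ f g f∘g≡id g∘f≡id
    ; pres = λ x y → mk⇔ (fromWitness ∘ preserve ∘ toWitness) (fromWitness ∘ reflect ∘ toWitness)
    }
    where
    π : Fin n → Permutation′ 3
    π v = proj₁ (extend-to-permutation (correspondence-matching A B v))
    π-extends : ∀ {v i j} → Corresponding PA PB v i j → π v ⟨$⟩ʳ i ≡ j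
    π-extends {v} = proj₂ (extend-to-permutation (correspondence-matching A B v))
    π⁻¹-extends : ∀ {v j i} → Corresponding PB PA v j i → π v ⟨$⟩ˡ j ≡ i
    π⁻¹-extends {v} r = trans (cong (π v ⟨$⟩ˡ_) (sym (π-extends (corresponding-swap r)))) (inverseˡ (π v))
    f : Fin mA → Fin mB
    f = Transfer.transfer A B (λ v → π v ⟨$⟩ʳ_) π-extends
    g : Fin mB → Fin mA
    g = Transfer.transfer B A (λ v → π v ⟨$⟩ˡ_) π⁻¹-extends
    g∘f≡id : ∀ x → g (f x) ≡ x
    g∘f≡id = transfer-inverse A B π-extends π⁻¹-extends λ v i → inverseˡ (π v)
    f∘g≡id : ∀ y → f (g y) ≡ y
    f∘g≡id = transfer-inverse B A π⁻¹-extends π-extends λ v j → inverseʳ (π v)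
    preserve : ∀ {x y} → Joined PA x y → Joined PB (f x) (f y)
    preserve {x} {y} (x≢y , xy) =
      (λ fx≡fy → x≢y (trans (sym (g∘f≡id x)) (trans (cong g fx≡fy) (g∘f≡id y)))) ,
      Transfer.transfer-collinear A B (λ v → π v ⟨$⟩ʳ_) π-extends xy
    reflect : ∀ {x y} → Joined PB (f x) (f y) → Joined PA x y
    reflect {x} {y} (fx≢fy , fxfy) =
      fx≢fy ∘ cong f ,
      subst₂ (Collinear PA) (g∘f≡id x) (g∘f≡id y)
        (Transfer.transfer-collinear B A (λ v → π v ⟨$⟩ˡ_) π⁻¹-extends fxfy)

module InducedSubgraphs {n : ℕ} (H : FinGraph n) where

  open TriangleProperties H

  edge : ∀ {x y} → Adj x y → x ≢ y × E H x y ≡ true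
  edge xy = adj⇒≢ xy , Equivalence.to Bool.T-≡ xy

  non-edge : ∀ {x y} → x ≢ y → ¬ Adj x y → x ≢ y × E H x y ≡ false
  non-edge {x} {y} x≢y ¬xy = x≢y , ¬T⇒false ¬xy
    where
    ¬T⇒false : ∀ {b} → ¬ T b → b ≡ false
    ¬T⇒false {false} _ = refl
    ¬T⇒false {true} ¬t = contradiction _ ¬t

  induced-from-pairs : ∀ {k} (P : Fin k → Fin k → Bool) →
    (∀ i j → P i j ≡ P j i) → (∀ i → P i i ≡ false) → (f : Fin k → Fin n) →
    (∀ {i j} → i <ᶠ j → f i ≢ f j × E H (f i) (f j) ≡ P i j) → HasInduced k P H
  induced-from-pairs P P-sym P-irrefl f pairs = f , injective , edges
    where
    injective : ∀ {i j} → f i ≡ f j → i ≡ j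
    injective {i} {j} fi≡fj with <-cmp i j
    ... | tri< i<j _ _ = contradiction fi≡fj (proj₁ (pairs i<j))
    ... | tri≈ _ i≡j _ = i≡j
    ... | tri> _ _ j<i = contradiction (sym fi≡fj) (proj₁ (pairs j<i))
    edges : ∀ i j → E H (f i) (f j) ≡ P i j
    edges i j with <-cmp i j
    ... | tri< i<j _ _ = proj₂ (pairs i<j)
    ... | tri≈ _ refl _ = trans (irrefl H (f i)) (sym (P-irrefl i))
    ... | tri> _ _ j<i = trans (FinGraph.sym H (f i) (f j)) (trans (proj₂ (pairs j<i)) (P-sym j i))

  Near : Fin n → Fin n → Set
  Near x y = x ≡ y ⊎ Adj x y

  private
    far : ∀ {x y} → ¬ Near x y → x ≢ y × E H x y ≡ false
    far ¬xy = non-edge (¬xy ∘ inj₁) (¬xy ∘ inj₂)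

  diamond : ∀ {p q r s} → Adj p q → Adj p r → Adj p s → Adj q r → Adj q s → ¬ Near r s →
            HasInduced 4 K4-e H
  diamond {p} {q} {r} {s} pq pr ps qr qs ¬rs = induced-from-pairs K4-e
    (from-yes (all? λ i → all? λ j → K4-e i j Bool.≟ K4-e j i))
    (from-yes (all? λ i → K4-e i i Bool.≟ false))
    vertex pairs
    where
    vertex : Fin 4 → Fin n
    vertex = p ∷ q ∷ r ∷ s ∷ []
    pairs : ∀ {i j} → i <ᶠ j → vertex i ≢ vertex j × E H (vertex i) (vertex j) ≡ K4-e i j
    pairs {zero} {suc zero} _ = edge pq
    pairs {zero} {suc (suc zero)} _ = edge pr
    pairs {zero} {suc (suc (suc zero))} _ = edge ps
    pairs {suc zero} {suc (suc zero)} _ = edge qr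
    pairs {suc zero} {suc (suc (suc zero))} _ = edge qs
    pairs {suc (suc zero)} {suc (suc (suc zero))} _ = far ¬rs
    pairs {suc _} {suc zero} (s≤s ())
    pairs {suc (suc _)} {suc (suc zero)} (s≤s (s≤s ()))
    pairs {suc (suc (suc _))} {suc (suc (suc zero))} (s≤s (s≤s (s≤s ())))

  claw : ∀ {c l₀ l₁ l₂ l₃} → Adj c l₀ → Adj c l₁ → Adj c l₂ → Adj c l₃ →
         ¬ Near l₀ l₁ → ¬ Near l₀ l₂ → ¬ Near l₀ l₃ → ¬ Near l₁ l₂ → ¬ Near l₁ l₃ → ¬ Near l₂ l₃ →
         HasInduced 5 K1,4 H
  claw {c} {l₀} {l₁} {l₂} {l₃} c₀ c₁ c₂ c₃ ¬01 ¬02 ¬03 ¬12 ¬13 ¬23 = induced-from-pairs K1,4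
    (from-yes (all? λ i → all? λ j → K1,4 i j Bool.≟ K1,4 j i))
    (from-yes (all? λ i → K1,4 i i Bool.≟ false))
    vertex pairs
    where
    vertex : Fin 5 → Fin n
    vertex = c ∷ l₀ ∷ l₁ ∷ l₂ ∷ l₃ ∷ []
    pairs : ∀ {i j} → i <ᶠ j → vertex i ≢ vertex j × E H (vertex i) (vertex j) ≡ K1,4 i j
    pairs {zero} {suc zero} _ = edge c₀
    pairs {zero} {suc (suc zero)} _ = edge c₁
    pairs {zero} {suc (suc (suc zero))} _ = edge c₂
    pairs {zero} {suc (suc (suc (suc zero)))} _ = edge c₃
    pairs {suc zero} {suc (suc zero)} _ = far ¬01
    pairs {suc zero} {suc (suc (suc zero))} _ = far ¬02
    pairs {suc zero} {suc (suc (suc (suc zero)))} _ = far ¬03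
    pairs {suc (suc zero)} {suc (suc (suc zero))} _ = far ¬12
    pairs {suc (suc zero)} {suc (suc (suc (suc zero)))} _ = far ¬13
    pairs {suc (suc (suc zero))} {suc (suc (suc (suc zero)))} _ = far ¬23
    pairs {suc _} {suc zero} (s≤s ())
    pairs {suc (suc _)} {suc (suc zero)} (s≤s (s≤s ()))
    pairs {suc (suc (suc _))} {suc (suc (suc zero))} (s≤s (s≤s (s≤s ())))
    pairs {suc (suc (suc (suc _)))} {suc (suc (suc (suc zero)))} (s≤s (s≤s (s≤s (s≤s ()))))

module Existence {n : ℕ} (H : FinGraph n)
  (no-K4-e : ¬ HasInduced 4 K4-e H) (no-K1,4 : ¬ HasInduced 5 K1,4 H) where

  open TriangleProperties H
  open InducedSubgraphs H
  open Realisations H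

  adj? : ∀ x y → Dec (Adj x y)
  adj? x y = T? (E H x y)

  near? : ∀ x y → Dec (Near x y)
  near? x y = (x ≟ y) ⊎-dec adj? x y

  near-sym : ∀ {x y} → Near x y → Near y x
  near-sym (inj₁ x≡y) = inj₁ (sym x≡y)
  near-sym (inj₂ xy) = inj₂ (adj-sym xy)

  -- Without an induced K4 - e, the neighbourhood of v is a disjoint union of cliques.
  near-trans : ∀ {v x y z} → Adj v x → Adj v y → Adj v z → Near x y → Near y z → Near x z
  near-trans _ _ _ (inj₁ refl) yz = yz
  near-trans _ _ _ xy (inj₁ refl) = xy
  near-trans {v} {x} {y} {z} vx vy vz (inj₂ xy) (inj₂ yz) with near? x z
  ... | yes xz = xz
  ... | no ¬xz = contradiction (diamond vy vx vz (adj-sym xy) yz ¬xz) no-K4-e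

  CoveredBy : Fin n → (Fin 3 → Fin n) → Set
  CoveredBy v r = ∀ w → Adj v w → ∃[ i ] (Adj v (r i) × Near (r i) w)

  covered-or-far : ∀ v (r : Fin 3 → Fin n) → (∀ i → Adj v (r i)) →
                   CoveredBy v r ⊎ ∃[ w ] (Adj v w × ∀ i → ¬ Near (r i) w)
  covered-or-far v r vr with any? (λ w → adj? v w ×-dec all? (λ i → ¬? (near? (r i) w)))
  ... | yes (w , vw , far) = inj₂ (w , vw , far)
  ... | no none = inj₁ λ w vw →
    let i , ¬¬near = ¬∀⟶∃¬ 3 _ (λ i → ¬? (near? (r i) w)) (λ far → none (w , vw , far))
    in i , vr i , decidable-stable (near? (r i) w) ¬¬near

  -- Greedily pick neighbours far from the previous ones; a fourth one would span an induced K1,4.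
  cover : ∀ v → ∃[ r ] CoveredBy v r
  cover v with any? (adj? v)
  ... | no isolated = (λ _ → v) , λ w vw → contradiction (w , vw) isolated
  ... | yes (r₀ , vr₀) with covered-or-far v (λ _ → r₀) (λ _ → vr₀)
  ... | inj₁ covered = _ , covered
  ... | inj₂ (r₁ , vr₁ , far₁)
    with covered-or-far v (r₀ ∷ r₁ ∷ r₁ ∷ []) (λ { zero → vr₀ ; (suc zero) → vr₁ ; (suc (suc zero)) → vr₁ })
  ... | inj₁ covered = _ , covered
  ... | inj₂ (r₂ , vr₂ , far₂)
    with covered-or-far v (r₀ ∷ r₁ ∷ r₂ ∷ []) (λ { zero → vr₀ ; (suc zero) → vr₁ ; (suc (suc zero)) → vr₂ })
  ... | inj₁ covered = _ , covered
  ... | inj₂ (w , vw , far₃) = contradiction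
    (claw vr₀ vr₁ vr₂ vw (far₁ zero) (far₂ zero) (far₃ zero)
      (far₂ (suc zero)) (far₃ (suc zero)) (far₃ (suc (suc zero))))
    no-K1,4

  representative : Fin n → Fin 3 → Fin n
  representative v = proj₁ (cover v)

  slot : Fin n → Fin n → Fin 3
  slot v w = firstIndex (λ i → adj? v (representative v i) ×-dec near? (representative v i) w)

  slot-spec : ∀ {v w} → Adj v w → Adj v (representative v (slot v w)) × Near (representative v (slot v w)) w
  slot-spec {v} {w} vw = firstIndex-satisfies _ (proj₂ (cover v) w vw)

  slot-cong : ∀ {v w w′} → Adj v w → Adj v w′ → Adj w w′ → slot v w ≡ slot v w′
  slot-cong vw vw′ ww′ = firstIndex-cong _ _ λ i → mk⇔
    (λ (vr , rw) → vr , near-trans vr vw vw′ rw (inj₂ ww′))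
    (λ (vr , rw′) → vr , near-trans vr vw′ vw rw′ (inj₂ (adj-sym ww′)))

  slot-injective : ∀ {v w w′} → Adj v w → Adj v w′ → slot v w ≡ slot v w′ → Near w w′
  slot-injective {v} {w} {w′} vw vw′ e =
    near-trans vw (proj₁ (slot-spec vw)) vw′ (near-sym (proj₂ (slot-spec vw)))
      (subst (λ i → Near (representative v i) w′) (sym e) (proj₂ (slot-spec vw′)))

  -- (v , i) names the i-th vertex of the triangle of v; slot v w is the one shared with the triangle of w.
  Same : Fin n × Fin 3 → Fin n × Fin 3 → Set
  Same (v , i) (w , j) = (v ≡ w × i ≡ j) ⊎ (Adj v w × slot v w ≡ i × slot w v ≡ j)

  same-refl : ∀ {p} → Same p p
  same-refl = inj₁ (refl , refl)

  same-sym : ∀ {p q} → Same p q → Same q p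
  same-sym (inj₁ (refl , refl)) = inj₁ (refl , refl)
  same-sym (inj₂ (vw , i , j)) = inj₂ (adj-sym vw , j , i)

  same-trans : ∀ {p q r} → Same p q → Same q r → Same p r
  same-trans (inj₁ (refl , refl)) qr = qr
  same-trans pq (inj₁ (refl , refl)) = pq
  same-trans {v , i} {w , j} {u , k} (inj₂ (vw , wv↦i , vw↦j)) (inj₂ (wu , uw↦j , wu↦k)) with v ≟ u
  ... | yes refl = inj₁ (refl , trans (sym wv↦i) wu↦k)
  ... | no v≢u with slot-injective (adj-sym vw) wu (trans vw↦j (sym uw↦j))
  ...   | inj₁ v≡u = contradiction v≡u v≢u
  ...   | inj₂ vu = inj₂ (vu , trans (slot-cong vu vw (adj-sym wu)) wv↦i ,
                          trans (slot-cong (adj-sym vu) (adj-sym wu) vw) wu↦k)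

  same? : ∀ p q → Dec (Same p q)
  same? (v , i) (w , j) = ((v ≟ w) ×-dec (i ≟ j)) ⊎-dec (adj? v w ×-dec (slot v w ≟ i) ×-dec (slot w v ≟ j))

  opaque
    quotient : FinQuotient (λ a b → Same (remQuot 3 a) (remQuot 3 b))
    quotient = finQuotient (record
      { isEquivalence = record { refl = same-refl ; sym = same-sym ; trans = same-trans }
      ; _≟_ = λ a b → same? (remQuot 3 a) (remQuot 3 b)
      })

  open FinQuotient quotient

  line : Fin n → Fin 3 → Fin size
  line v i = class (combine v i)

  line-≡⇒same : ∀ {v i w j} → line v i ≡ line w j → Same (v , i) (w , j)
  line-≡⇒same {v} {i} {w} {j} e = subst₂ Same (remQuot-combine v i) (remQuot-combine w j) (class-sound e)

  same⇒line-≡ : ∀ {v i w j} → Same (v , i) (w , j) → line v i ≡ line w j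
  same⇒line-≡ {v} {i} {w} {j} s =
    class-complete (subst₂ Same (sym (remQuot-combine v i)) (sym (remQuot-combine w j)) s)

  meet-in-slot : ∀ {v w x} → v ≢ w → x ∈₃ line v → x ∈₃ line w → x ≡ line v (slot v w)
  meet-in-slot v≢w (i , refl) (j , j↦x) with line-≡⇒same (sym j↦x)
  ... | inj₁ (v≡w , _) = contradiction v≡w v≢w
  ... | inj₂ (_ , vw↦i , _) = cong (line _) (sym vw↦i)

  isRealisation : IsRealisation line
  isRealisation = record
    { line-injective = line-injective
    ; adjacent⇒meet = λ {v} {w} vw →
        line v (slot v w) , (slot v w , refl) , (slot w v , same⇒line-≡ (inj₂ (adj-sym vw , refl , refl)))
    ; meet⇒adjacent = meet⇒adjacent
    ; meet-unique = λ v≢w x∈v x∈w y∈v y∈w → trans (meet-in-slot v≢w x∈v x∈w) (sym (meet-in-slot v≢w y∈v y∈w))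
    ; triangle-on-line = triangle-on-line
    ; covered = λ x → let a , a↦x = class-surjective x in
        proj₁ (remQuot {n} 3 a) , proj₂ (remQuot {n} 3 a) , trans (cong class (combine-remQuot {n} 3 a)) a↦x
    }
    where
    line-injective : ∀ v → Injective _≡_ _≡_ (line v)
    line-injective v e with line-≡⇒same e
    ... | inj₁ (_ , i≡j) = i≡j
    ... | inj₂ (vv , _) = contradiction refl (adj⇒≢ vv)
    meet⇒adjacent : ∀ {v w x} → v ≢ w → x ∈₃ line v → x ∈₃ line w → Adj v w
    meet⇒adjacent v≢w (i , i↦x) (j , j↦x) with line-≡⇒same (trans i↦x (sym j↦x))
    ... | inj₁ (v≡w , _) = contradiction v≡w v≢w
    ... | inj₂ (vw , _) = vw
    triangle-on-line : ∀ {x y z} → x ≢ y → y ≢ z → x ≢ z →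
                       Collinear line x y → Collinear line y z → Collinear line x z →
                       ∃[ v ] (x ∈₃ line v × y ∈₃ line v × z ∈₃ line v)
    triangle-on-line {x} {y} x≢y y≢z x≢z (u , x∈u , y∈u) (v , y∈v , z∈v) (w , x∈w , z∈w)
      with u ≟ v | u ≟ w | v ≟ w
    ... | yes refl | _ | _ = u , x∈u , y∈u , z∈v
    ... | no _ | yes refl | _ = u , x∈u , y∈u , z∈w
    ... | no _ | no _ | yes refl = v , x∈w , y∈v , z∈v
    ... | no u≢v | no u≢w | no v≢w = contradiction (begin
        x                 ≡⟨ meet-in-slot u≢w x∈u x∈w ⟩
        line u (slot u w) ≡⟨ cong (line u) (slot-cong (meet⇒adjacent u≢w x∈u x∈w) (meet⇒adjacent u≢v y∈u y∈v)
                                                       (adj-sym (meet⇒adjacent v≢w z∈v z∈w))) ⟩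
        line u (slot u v) ≡⟨ meet-in-slot u≢v y∈u y∈v ⟨
        y                 ∎) x≢y
      where open ≡-Reasoning

  realisation : ∃[ m ] Σ[ P ∈ (Fin n → Fin 3 → Fin m) ] IsRealisation P
  realisation = size , line , isRealisation

theorem2 : (n : ℕ) (H : FinGraph n) →
    ¬ HasInduced 4 K4-e H →
    ¬ HasInduced 5 K1,4 H →
    (∃[ G ] (LocallyLinear G × (TriangleGraph G ≅ ⟦ (n , H) ⟧))) ×
    (∀ G G' → LocallyLinear G → LocallyLinear G' →
      TriangleGraph G ≅ ⟦ (n , H) ⟧ → TriangleGraph G' ≅ ⟦ (n , H) ⟧ →
      ⟦ G ⟧ ≅ ⟦ G' ⟧)
theorem2 n H no-K4-e no-K1,4 = existence , uniqueness
  where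
  open Realisations H
  existence : ∃[ G ] (LocallyLinear G × (TriangleGraph G ≅ ⟦ (n , H) ⟧))
  existence with m , P , R ← Existence.realisation H no-K4-e no-K1,4 =
    (m , collinearityGraph P) , FromRealisation.locallyLinear R , FromRealisation.triangleGraph≅ R
  uniqueness : ∀ G G′ → LocallyLinear G → LocallyLinear G′ →
               TriangleGraph G ≅ ⟦ (n , H) ⟧ → TriangleGraph G′ ≅ ⟦ (n , H) ⟧ → ⟦ G ⟧ ≅ ⟦ G′ ⟧
  uniqueness (m , G) (m′ , G′) ll ll′ ψ ψ′ =
    ≅-trans A.≅collinearityGraph
      (≅-trans (Uniqueness.realisations-isomorphic H A.isRealisation B.isRealisation) B.collinearityGraph≅)
    where
    module A = FromLocallyLinear H G ll ψ
    module B = FromLocallyLinear H G′ ll′ ψ′
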